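{- Let $X:\mathcal U$ be a set and $\mathcal V$ a universe. For every pointed $\mathcal V$-dcpo $D$ (with carrier and order in arbitrary universes) and every function $f:X\to D$, there is a unique strict Scott continuous function $\bar f:\mathcal L_{\mathcal V}(X)\to D$ such that $\bar f\circ\eta_X=f$.
   Context: Setting: intensional Martin-Löf type theory with universes, function extensionality, propositional extensionality and propositional truncations; no excluded middle or resizing. A poset is a type with a proposition-valued reflexive, transitive, antisymmetric relation $\sqsubseteq$. A family $\alpha:I\to D$ is directed if $I$ is inhabited and for all $i,j$ there exists $k$ with $\alpha_i,\alpha_j\sqsubseteq\alpha_k$. A $\mathcal V$-dcpo is a poset in which every directed family indexed by a type $I:\mathcal V$ has a least upper bound; it is pointed if it has a least element $\bot$. A map between $\mathcal V$-dcpos is Scott continuous if it preserves suprema of directed families indexed by types in $\mathcal V$, and strict if it preserves $\bot$. The lifting $\mathcal L_{\mathcal V}(X):=\Sigma_{P:\Omega_{\mathcal V}}(P\to X)$ ($\Omega_{\mathcal V}$ the type of propositions in $\mathcal V$); for $l=(P,\varphi)$ write $\mathrm{isdefined}(l)=P$. It is ordered by $l\sqsubseteq m$ iff $\mathrm{isdefined}(l)\to l=m$; with this order it is a pointed $\mathcal V$-dcpo with least element $(\mathbf 0_{\mathcal V},!)$. The map $\eta_X:X\to\mathcal L_{\mathcal V}(X)$ is $x\mapsto(\mathbf 1_{\mathcal V},\lambda u.x)$. -}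

{-# OPTIONS --without-K #-}
module Defs where

-- Univalent-foundations setting: intensional MLTT (--without-K) with
-- function extensionality, propositional extensionality and propositional
-- truncations.  These three principles are not available in --safe Agda,
-- so they are stated here as types and taken as explicit hypotheses of
-- the main theorem.

open import Level using (Level; _⊔_; suc; Lift; lift; Setω)
open import Data.Product using (Σ; _,_; proj₁; proj₂; _×_)
open import Data.Unit using (⊤; tt)
open import Data.Empty using (⊥)
open import Function using (_∘_)
open import Relation.Binary.PropositionalEquality using (_≡_; refl)

isProp : ∀ {ℓ} → Set ℓ → Set ℓ
isProp A = (x y : A) → x ≡ y

isSet : ∀ {ℓ} → Set ℓ → Set ℓ
isSet A = (x y : A) → isProp (x ≡ y)

isContr : ∀ {ℓ} → Set ℓ → Set ℓ
isContr A = Σ A (λ c → (x : A) → c ≡ x)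

∃! : ∀ {ℓ ℓ'} (A : Set ℓ) → (A → Set ℓ') → Set (ℓ ⊔ ℓ')
∃! A B = isContr (Σ A B)

FunExt : Setω
FunExt = ∀ {a b} {A : Set a} {B : A → Set b} {f g : (x : A) → B x}
         → ((x : A) → f x ≡ g x) → f ≡ g

PropExt : Setω
PropExt = ∀ {ℓ} {P Q : Set ℓ} → isProp P → isProp Q → (P → Q) → (Q → P) → P ≡ Q

record PropTrunc : Setω where
  field
    ∥_∥      : ∀ {ℓ} → Set ℓ → Set ℓ
    ∥∥-isProp : ∀ {ℓ} {A : Set ℓ} → isProp ∥ A ∥
    ∣_∣      : ∀ {ℓ} {A : Set ℓ} → A → ∥ A ∥
    ∥∥-rec   : ∀ {ℓ ℓ'} {A : Set ℓ} {P : Set ℓ'} → isProp P → (A → P) → ∥ A ∥ → P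

Ω : (𝓥 : Level) → Set (suc 𝓥)
Ω 𝓥 = Σ (Set 𝓥) isProp

module WithPT (pt : PropTrunc) where
  open PropTrunc pt

  ∃∥ : ∀ {ℓ ℓ'} (A : Set ℓ) → (A → Set ℓ') → Set (ℓ ⊔ ℓ')
  ∃∥ A B = ∥ Σ A B ∥

  module _ {𝓤 𝓣 : Level} {D : Set 𝓤} (_⊑_ : D → D → Set 𝓣) where

    isDirected : ∀ {𝓘} {I : Set 𝓘} → (I → D) → Set (𝓘 ⊔ 𝓣)
    isDirected {I = I} α =
      ∥ I ∥ × ((i j : I) → ∃∥ I (λ k → (α i ⊑ α k) × (α j ⊑ α k)))

    isUpperBound : ∀ {𝓘} {I : Set 𝓘} → D → (I → D) → Set (𝓘 ⊔ 𝓣)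
    isUpperBound {I = I} u α = (i : I) → α i ⊑ u

    isSup : ∀ {𝓘} {I : Set 𝓘} → D → (I → D) → Set (𝓤 ⊔ 𝓘 ⊔ 𝓣)
    isSup s α = isUpperBound s α × ((u : D) → isUpperBound u α → s ⊑ u)

    isLeast : D → Set (𝓤 ⊔ 𝓣)
    isLeast b = (x : D) → b ⊑ x

  record PointedDCPO (𝓥 𝓤 𝓣 : Level) : Set (suc (𝓥 ⊔ 𝓤 ⊔ 𝓣)) where
    field
      ⟨_⟩       : Set 𝓤
      _⊑_       : ⟨_⟩ → ⟨_⟩ → Set 𝓣
      ⊑-prop    : (x y : ⟨_⟩) → isProp (x ⊑ y)
      ⊑-refl    : (x : ⟨_⟩) → x ⊑ x
      ⊑-trans   : (x y z : ⟨_⟩) → x ⊑ y → y ⊑ z → x ⊑ z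
      ⊑-antisym : (x y : ⟨_⟩) → x ⊑ y → y ⊑ x → x ≡ y
      ∐         : {I : Set 𝓥} (α : I → ⟨_⟩) → isDirected _⊑_ α → ⟨_⟩
      ∐-isSup   : {I : Set 𝓥} (α : I → ⟨_⟩) (δ : isDirected _⊑_ α)
                  → isSup _⊑_ (∐ α δ) α
      ⊥D        : ⟨_⟩
      ⊥D-least  : isLeast _⊑_ ⊥D

  module _ (𝓥 : Level) {𝓤 : Level} (X : Set 𝓤) where

    𝓛 : Set (suc 𝓥 ⊔ 𝓤)
    𝓛 = Σ (Ω 𝓥) (λ P → proj₁ P → X)

    isdefined : 𝓛 → Set 𝓥
    isdefined l = proj₁ (proj₁ l)

    _⊑𝓛_ : 𝓛 → 𝓛 → Set (suc 𝓥 ⊔ 𝓤)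
    l ⊑𝓛 m = isdefined l → l ≡ m

    ⊥𝓛 : 𝓛
    ⊥𝓛 = (Lift 𝓥 ⊥ , (λ { () })) , (λ { () })

    η : X → 𝓛
    η x = (Lift 𝓥 ⊤ , (λ _ _ → refl)) , (λ _ → x)

  module _ {𝓥 𝓤 𝓤' 𝓣' : Level} {X : Set 𝓤} (D : PointedDCPO 𝓥 𝓤' 𝓣') where
    open PointedDCPO D

    isStrict : (𝓛 𝓥 X → ⟨_⟩) → Set 𝓤'
    isStrict g = g (⊥𝓛 𝓥 X) ≡ ⊥D

    isScottContinuous : (𝓛 𝓥 X → ⟨_⟩) → Set (suc 𝓥 ⊔ 𝓤 ⊔ 𝓤' ⊔ 𝓣')
    isScottContinuous g =
      {I : Set 𝓥} (α : I → 𝓛 𝓥 X) → isDirected (_⊑𝓛_ 𝓥 X) α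
      → (s : 𝓛 𝓥 X) → isSup (_⊑𝓛_ 𝓥 X) s α → isSup _⊑_ (g s) (g ∘ α)

module Submission where

-- The extension f̄ sends a partial element l to the supremum of the directed family
-- consisting of ⊥ together with f(l) when l is defined.  Uniqueness holds because every
-- l is itself the supremum of ⊥ together with η(l) when defined, so a strict continuous
-- extension of f is forced on it.  Continuity rests on the observation that a supremum in
-- the lifting is defined only if some member of the family is.

open import Defs
open import Level using (Level; Lift; lift; suc; _⊔_)
open import Data.Product using (Σ; _×_; _,_; proj₁; proj₂)
open import Data.Sum using (_⊎_; inj₁; inj₂)
open import Data.Unit using (⊤; tt)
open import Function using (_∘_)
open import Relation.Binary.PropositionalEquality using (_≡_; refl; sym; trans; cong; subst; cong-app)
open import Relation.Binary.PropositionalEquality.Properties using (trans-symˡ)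

×-isProp : ∀ {a b} {A : Set a} {B : Set b} → isProp A → isProp B → isProp (A × B)
×-isProp pA pB (a , b) (a' , b') with pA a a' | pB b b'
... | refl | refl = refl

Σ-≡-prop : ∀ {a b} {A : Set a} {B : A → Set b} → (∀ x → isProp (B x))
  → {x y : A} {u : B x} {v : B y} → x ≡ y → (x , u) ≡ (y , v)
Σ-≡-prop pB {x} refl = cong (x ,_) (pB x _ _)

-- Each path p is determined by the witness subst (R x) p (r x), which ranges over a proposition.
propRelation→isSet : ∀ {a r} {A : Set a} (R : A → A → Set r) → (∀ x y → isProp (R x y))
  → (∀ x → R x x) → (∀ x y → R x y → x ≡ y) → isSet A
propRelation→isSet R R-prop r toPath x y p q =
  trans (normal p) (trans (cong (trans (sym (toPath x x (r x))) ∘ toPath x y) (R-prop x y _ _))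
                          (sym (normal q)))
  where
  normal : ∀ {y} (p : x ≡ y) → p ≡ trans (sym (toPath x x (r x))) (toPath x y (subst (R x) p (r x)))
  normal refl = sym (trans-symˡ (toPath x x (r x)))

isProp→isSet : ∀ {a} {A : Set a} → isProp A → isSet A
isProp→isSet pA = propRelation→isSet (λ _ _ → ⊤) (λ _ _ _ _ → refl) (λ _ → tt) (λ x y _ → pA x y)

module _ (fe : FunExt) where

  Π-isProp : ∀ {a b} {A : Set a} {B : A → Set b} → (∀ x → isProp (B x)) → isProp ((x : A) → B x)
  Π-isProp pB g h = fe λ x → pB x (g x) (h x)

  isProp-isProp : ∀ {a} {A : Set a} → isProp (isProp A)
  isProp-isProp p q = fe λ x → fe λ y → isProp→isSet p x y (p x y) (q x y)

  →-isSet : ∀ {a b} {A : Set a} {B : Set b} → isSet B → isSet (A → B)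
  →-isSet sB = propRelation→isSet (λ g h → ∀ x → g x ≡ h x) (λ g h → Π-isProp λ x → sB _ _)
                 (λ g x → refl) (λ g h → fe)

module _ (pt : PropTrunc) where
  open PropTrunc pt
  open WithPT pt

  adjoin : ∀ {a 𝓥} {A : Set a} {P : Set 𝓥} → A → (P → A) → Lift 𝓥 ⊤ ⊎ P → A
  adjoin b v (inj₁ _) = b
  adjoin b v (inj₂ p) = v p

  adjoin-isDirected : ∀ {a r 𝓥} {A : Set a} (R : A → A → Set r) → (∀ x → R x x)
    → (b : A) → (∀ x → R b x) → {P : Set 𝓥} → isProp P → (v : P → A)
    → isDirected R (adjoin b v)
  adjoin-isDirected R r b b-least P-prop v = ∣ inj₁ (lift _) ∣ , bound
    where
    bound : ∀ i j → ∃∥ _ (λ k → R (adjoin b v i) (adjoin b v k) × R (adjoin b v j) (adjoin b v k))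
    bound (inj₁ _) (inj₁ _) = ∣ inj₁ (lift _) , r b , r b ∣
    bound (inj₁ _) (inj₂ q) = ∣ inj₂ q , b-least (v q) , r (v q) ∣
    bound (inj₂ p) (inj₁ _) = ∣ inj₂ p , r (v p) , b-least (v p) ∣
    bound (inj₂ p) (inj₂ q) = ∣ inj₂ p , r (v p) , subst (λ w → R (v w) (v p)) (P-prop p q) (r (v p)) ∣

  module _ {𝓥 𝓤 𝓣} (D : PointedDCPO 𝓥 𝓤 𝓣) where
    open PointedDCPO D

    carrier-isSet : isSet ⟨_⟩
    carrier-isSet = propRelation→isSet (λ x y → (x ⊑ y) × (y ⊑ x))
      (λ x y → ×-isProp (⊑-prop x y) (⊑-prop y x))
      (λ x → ⊑-refl x , ⊑-refl x) (λ x y (le , ge) → ⊑-antisym x y le ge)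

    sup-unique : ∀ {I : Set 𝓥} {α β : I → ⟨_⟩} {s t : ⟨_⟩} → isSup _⊑_ s α → isSup _⊑_ t β
      → (∀ i → α i ≡ β i) → s ≡ t
    sup-unique {s = s} {t} (s-ub , s-least) (t-ub , t-least) α≡β =
      ⊑-antisym _ _ (s-least _ (λ i → subst (_⊑ t) (sym (α≡β i)) (t-ub i)))
                    (t-least _ (λ i → subst (_⊑ s) (α≡β i) (s-ub i)))

    isScottContinuous-isProp : FunExt → ∀ {𝓤₀} {X : Set 𝓤₀} (g : 𝓛 𝓥 X → ⟨_⟩)
      → isProp (isScottContinuous D g)
    isScottContinuous-isProp fe g c c' = cong (λ k {I} → k I) (fe λ I →
      Π-isProp fe (λ α → Π-isProp fe λ _ → Π-isProp fe λ s → Π-isProp fe λ _ →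
        ×-isProp (Π-isProp fe λ _ → ⊑-prop _ _) (Π-isProp fe λ _ → Π-isProp fe λ _ → ⊑-prop _ _))
      (c {I}) (c' {I}))

  module Lifting (fe : FunExt) (pe : PropExt) (𝓥 : Level) {𝓤 : Level} (X : Set 𝓤) where

    L : Set (suc 𝓥 ⊔ 𝓤)
    L = 𝓛 𝓥 X

    _⊑L_ : L → L → Set (suc 𝓥 ⊔ 𝓤)
    _⊑L_ = _⊑𝓛_ 𝓥 X

    defined : L → Set 𝓥
    defined = isdefined 𝓥 X

    defined-isProp : (l : L) → isProp (defined l)
    defined-isProp l = proj₂ (proj₁ l)

    value : (l : L) → defined l → X
    value = proj₂

    𝓛-≡ : {P Q : Set 𝓥} (P-prop : isProp P) (Q-prop : isProp Q) (φ : P → X) (ψ : Q → X)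
      (e : P → Q) → (Q → P) → (∀ p → φ p ≡ ψ (e p))
      → _≡_ {A = L} ((P , P-prop) , φ) ((Q , Q-prop) , ψ)
    𝓛-≡ {P} P-prop Q-prop φ ψ e e' agree = along (pe P-prop Q-prop e e') Q-prop ψ e agree
      where
      along : ∀ {Q} → P ≡ Q → (Q-prop : isProp Q) (ψ : Q → X) (e : P → Q)
        → (∀ p → φ p ≡ ψ (e p)) → _≡_ {A = L} ((P , P-prop) , φ) ((Q , Q-prop) , ψ)
      along refl Q-prop ψ e agree
        with isProp-isProp fe P-prop Q-prop | fe (λ p → trans (agree p) (cong ψ (P-prop (e p) p)))
      ... | refl | refl = refl

    η-value : (l : L) (p : defined l) → η 𝓥 X (value l p) ≡ l
    η-value ((P , P-prop) , φ) p = 𝓛-≡ _ P-prop _ φ (λ _ → p) (λ _ → lift _) (λ _ → refl)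

    ⊥∪η : (l : L) → Lift 𝓥 ⊤ ⊎ defined l → L
    ⊥∪η l = adjoin (⊥𝓛 𝓥 X) (η 𝓥 X ∘ value l)

    ⊥∪η-isDirected : (l : L) → isDirected _⊑L_ (⊥∪η l)
    ⊥∪η-isDirected l =
      adjoin-isDirected _⊑L_ (λ _ _ → refl) (⊥𝓛 𝓥 X) (λ _ ()) (defined-isProp l) (η 𝓥 X ∘ value l)

    ⊥∪η-isSup : (l : L) → isSup _⊑L_ l (⊥∪η l)
    ⊥∪η-isSup l = upper , least
      where
      upper : isUpperBound _⊑L_ l (⊥∪η l)
      upper (inj₁ _) ()
      upper (inj₂ p) _ = η-value l p
      least : (u : L) → isUpperBound _⊑L_ u (⊥∪η l) → l ⊑L u
      least u u-ub p = trans (sym (η-value l p)) (u-ub (inj₂ p) _)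

    -- The restriction of s to "some α i is defined" is still an upper bound of α, so it lies
    -- above s and is therefore defined whenever s is.
    sup-defined→∃-defined : {I : Set 𝓥} {α : I → L} {s : L} → isSup _⊑L_ s α
      → defined s → ∃∥ I (defined ∘ α)
    sup-defined→∃-defined {I} {α} {s} (s-ub , s-least) p =
      proj₂ (subst defined (s-least restricted restricted-ub p) p)
      where
      restricted : L
      restricted = ((defined s × ∃∥ I (defined ∘ α)) , ×-isProp (defined-isProp s) ∥∥-isProp)
                 , value s ∘ proj₁
      restricted-ub : isUpperBound _⊑L_ restricted α
      restricted-ub i d = trans (s-ub i d)
        (𝓛-≡ _ _ _ _ (_, ∣ i , d ∣) proj₁ (λ _ → refl))

    module Extension {𝓤' 𝓣' : Level} (D : PointedDCPO 𝓥 𝓤' 𝓣') (f : X → PointedDCPO.⟨_⟩ D) where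
      open PointedDCPO D

      ⊥∪f : (l : L) → Lift 𝓥 ⊤ ⊎ defined l → ⟨_⟩
      ⊥∪f l = adjoin ⊥D (f ∘ value l)

      ⊥∪f-isDirected : (l : L) → isDirected _⊑_ (⊥∪f l)
      ⊥∪f-isDirected l = adjoin-isDirected _⊑_ ⊑-refl ⊥D ⊥D-least (defined-isProp l) (f ∘ value l)

      f̄ : L → ⟨_⟩
      f̄ l = ∐ (⊥∪f l) (⊥∪f-isDirected l)

      f̄-upper : (l : L) (p : defined l) → f (value l p) ⊑ f̄ l
      f̄-upper l p = proj₁ (∐-isSup (⊥∪f l) (⊥∪f-isDirected l)) (inj₂ p)

      f̄-least : (l : L) (u : ⟨_⟩) → ((p : defined l) → f (value l p) ⊑ u) → f̄ l ⊑ u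
      f̄-least l u u-ub = proj₂ (∐-isSup (⊥∪f l) (⊥∪f-isDirected l)) u upper
        where
        upper : isUpperBound _⊑_ u (⊥∪f l)
        upper (inj₁ _) = ⊥D-least u
        upper (inj₂ p) = u-ub p

      f̄-monotone : (l m : L) → l ⊑L m → f̄ l ⊑ f̄ m
      f̄-monotone l m l⊑m =
        f̄-least l (f̄ m) λ p → subst (λ k → f (value l p) ⊑ f̄ k) (l⊑m p) (f̄-upper l p)

      f̄-isStrict : isStrict D f̄
      f̄-isStrict = ⊑-antisym _ _ (f̄-least (⊥𝓛 𝓥 X) ⊥D (λ ())) (⊥D-least _)

      f̄∘η : f̄ ∘ η 𝓥 X ≡ f
      f̄∘η = fe λ x → ⊑-antisym _ _ (f̄-least (η 𝓥 X x) (f x) (λ _ → ⊑-refl (f x)))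
                                   (f̄-upper (η 𝓥 X x) (lift _))

      f̄-isScottContinuous : isScottContinuous D f̄
      f̄-isScottContinuous α _ s s-sup@(s-ub , _) = (λ i → f̄-monotone (α i) s (s-ub i)) , least
        where
        least : (u : ⟨_⟩) → isUpperBound _⊑_ u (f̄ ∘ α) → f̄ s ⊑ u
        least u u-ub = f̄-least s u λ p →
          ∥∥-rec (⊑-prop _ _)
            (λ (i , d) → ⊑-trans _ _ _ (f̄-upper s p) (subst (λ k → f̄ k ⊑ u) (s-ub i d) (u-ub i)))
            (sup-defined→∃-defined s-sup p)

      f̄-unique : (g : L → ⟨_⟩) → isStrict D g → isScottContinuous D g → g ∘ η 𝓥 X ≡ f
        → (l : L) → f̄ l ≡ g l
      f̄-unique g g-strict g-continuous g∘η l =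
        sup-unique D (∐-isSup (⊥∪f l) (⊥∪f-isDirected l))
          (g-continuous (⊥∪η l) (⊥∪η-isDirected l) l (⊥∪η-isSup l)) agree
        where
        agree : ∀ i → ⊥∪f l i ≡ g (⊥∪η l i)
        agree (inj₁ _) = sym g-strict
        agree (inj₂ p) = sym (cong-app g∘η (value l p))

      isExtension-isProp : (g : L → ⟨_⟩)
        → isProp (isStrict D g × isScottContinuous D g × (g ∘ η 𝓥 X ≡ f))
      isExtension-isProp g = ×-isProp (carrier-isSet D _ _)
        (×-isProp (isScottContinuous-isProp D fe g) (→-isSet fe (carrier-isSet D) _ _))

mainTheorem12 : FunExt → PropExt → (pt : PropTrunc)
    → {𝓤 : Level} (X : Set 𝓤) → isSet X → (𝓥 : Level)
    → {𝓤' 𝓣' : Level} (D : WithPT.PointedDCPO pt 𝓥 𝓤' 𝓣')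
    → (f : X → WithPT.PointedDCPO.⟨_⟩ D)
    → ∃! (WithPT.𝓛 pt 𝓥 X → WithPT.PointedDCPO.⟨_⟩ D)
    (λ g → WithPT.isStrict pt D g × WithPT.isScottContinuous pt D g
    × (g ∘ WithPT.η pt 𝓥 X ≡ f))
mainTheorem12 fe pe pt X _ 𝓥 D f =
  (f̄ , f̄-isStrict , f̄-isScottContinuous , f̄∘η) ,
  λ (g , g-strict , g-continuous , g∘η) →
    Σ-≡-prop isExtension-isProp (fe (f̄-unique g g-strict g-continuous g∘η))
  where
  open Lifting pt fe pe 𝓥 X
  open Extension D f
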